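{- A finite simple graph $G$ is a proper $2$-color-line graph if and only if $G$ is co-bipartite and contains none of $K_5-e$, $F_1$, $F_2$, $F_3$, $F_4$ as an induced subgraph.
   Context: A graph is co-bipartite if its vertex set can be partitioned into two (possibly empty) cliques, i.e., its complement is bipartite. $K_5-e$ is the complete graph on $5$ vertices minus one edge. Each $F_j$ has vertex set $\{a_1,a_2,a_3,b_1,b_2,b_3,u\}$ where $\{a_1,a_2,a_3\}$ and $\{b_1,b_2,b_3\}$ are triangles and $u$ is adjacent to all six other vertices; in $F_1$ there are no edges between $\{a_1,a_2,a_3\}$ and $\{b_1,b_2,b_3\}$; $F_2$ additionally has the edge $a_1b_1$; $F_3$ additionally has the edges $a_1b_1,a_2b_2$; $F_4$ additionally has the edges $a_1b_1,a_2b_2,a_3b_3$ (and no other edges between the triangles). An edge $2$-coloring $\phi:E(H)\to\{1,2\}$ is proper if any two distinct edges sharing an endvertex get different colors. For an edge-colored graph $(H,\phi)$, $\mathrm{CL}(H)$ has vertex set $E(H)$, two distinct vertices being adjacent iff the corresponding edges share an endvertex or have the same color. $G$ is a proper $2$-color-line graph if $G\cong\mathrm{CL}(H)$ for some graph $H$ with a proper edge $2$-coloring. -}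

module Defs where

open import Data.Nat using (ℕ; _<_)
open import Data.Fin using (Fin; toℕ; _≟_)
open import Data.Bool using (Bool; true; false; _∧_; _∨_; not)
open import Data.Bool.Properties using (∨-comm)
open import Data.List using (List; []; _∷_)
open import Data.Bool.ListAction using (any)
open import Data.Product using (Σ; Σ-syntax; ∃; ∃-syntax; _×_; _,_; proj₁; proj₂)
open import Data.Sum using (_⊎_)
open import Relation.Nullary using (¬_; ⌊_⌋; yes; no)
open import Relation.Binary.PropositionalEquality using (_≡_; _≢_; refl)
open import Function.Bundles using (_↔_)
open import Function.Definitions using (Injective)

record Graph : Set where
  field
    n      : ℕ
    adj    : Fin n → Fin n → Bool
    sym    : ∀ x y → adj x y ≡ adj y x
    irrefl : ∀ x → adj x x ≡ false
open Graph public

V : Graph → Set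
V G = Fin (n G)

Adj : (G : Graph) → V G → V G → Set
Adj G x y = adj G x y ≡ true

private
  test : ∀ {k} → List (Fin k × Fin k) → Fin k → Fin k → Bool
  test es i j = not ⌊ i ≟ j ⌋ ∧ any (λ e → ⌊ proj₁ e ≟ i ⌋ ∧ ⌊ proj₂ e ≟ j ⌋) es

  test-irr : ∀ {k} (es : List (Fin k × Fin k)) (i : Fin k) → test es i i ≡ false
  test-irr es i with i ≟ i
  ... | yes _ = refl
  ... | no ¬p with ¬p refl
  ... | ()

fromEdges : (k : ℕ) → List (Fin k × Fin k) → Graph
fromEdges k es = record
  { n = k
  ; adj = λ i j → test es i j ∨ test es j i
  ; sym = λ i j → ∨-comm (test es i j) (test es j i)
  ; irrefl = λ i → irr i
  }
  where
    irr : ∀ i → (test es i i ∨ test es i i) ≡ false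
    irr i rewrite test-irr es i = refl

CoBipartite : Graph → Set
CoBipartite G =
  Σ[ side ∈ (V G → Bool) ] (∀ x y → x ≢ y → side x ≡ side y → Adj G x y)

InducedSubgraph : Graph → Graph → Set
InducedSubgraph F G =
  Σ[ f ∈ (V F → V G) ] (Injective _≡_ _≡_ f × (∀ x y → adj F x y ≡ adj G (f x) (f y)))

K5-e : Graph
K5-e = fromEdges 5
  ( (0F , 2F) ∷ (0F , 3F) ∷ (0F , 4F) ∷ (1F , 2F) ∷ (1F , 3F) ∷ (1F , 4F)
  ∷ (2F , 3F) ∷ (2F , 4F) ∷ (3F , 4F) ∷ [])
  where
    open import Data.Fin using (zero; suc)
    0F 1F 2F 3F 4F : Fin 5
    0F = zero
    1F = suc zero
    2F = suc (suc zero)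
    3F = suc (suc (suc zero))
    4F = suc (suc (suc (suc zero)))

module FVerts where
  open import Data.Fin using (zero; suc)
  a1 a2 a3 b1 b2 b3 u : Fin 7
  a1 = zero
  a2 = suc zero
  a3 = suc (suc zero)
  b1 = suc (suc (suc zero))
  b2 = suc (suc (suc (suc zero)))
  b3 = suc (suc (suc (suc (suc zero))))
  u  = suc (suc (suc (suc (suc (suc zero)))))

  baseEdges : List (Fin 7 × Fin 7)
  baseEdges =
      (a1 , a2) ∷ (a1 , a3) ∷ (a2 , a3)
    ∷ (b1 , b2) ∷ (b1 , b3) ∷ (b2 , b3)
    ∷ (u , a1) ∷ (u , a2) ∷ (u , a3) ∷ (u , b1) ∷ (u , b2) ∷ (u , b3) ∷ []
open FVerts

F₁ F₂ F₃ F₄ : Graph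
F₁ = fromEdges 7 baseEdges
F₂ = fromEdges 7 ((a1 , b1) ∷ baseEdges)
F₃ = fromEdges 7 ((a1 , b1) ∷ (a2 , b2) ∷ baseEdges)
F₄ = fromEdges 7 ((a1 , b1) ∷ (a2 , b2) ∷ (a3 , b3) ∷ baseEdges)

-- Edges of H: unordered pairs {i,j} with i < j (as numbers) and i ~ j

Edge : Graph → Set
Edge H = Σ[ i ∈ V H ] Σ[ j ∈ V H ] (toℕ i < toℕ j × Adj H i j)

endpoint₁ endpoint₂ : (H : Graph) → Edge H → V H
endpoint₁ H (i , _) = i
endpoint₂ H (_ , j , _) = j

ShareEnd : {H : Graph} → Edge H → Edge H → Set
ShareEnd {H} e f = (endpoint₁ H e ≡ endpoint₁ H f) ⊎ (endpoint₁ H e ≡ endpoint₂ H f)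
                 ⊎ (endpoint₂ H e ≡ endpoint₁ H f) ⊎ (endpoint₂ H e ≡ endpoint₂ H f)

ProperColouring : (H : Graph) → (Edge H → Fin 2) → Set
ProperColouring H φ = ∀ e f → e ≢ f → ShareEnd {H} e f → φ e ≢ φ f

CLAdj : (H : Graph) → (Edge H → Fin 2) → Edge H → Edge H → Set
CLAdj H φ e f = e ≢ f × (ShareEnd {H} e f ⊎ φ e ≡ φ f)

IsoCL : (G H : Graph) → (Edge H → Fin 2) → Set
IsoCL G H φ = Σ[ σ ∈ (V G ↔ Edge H) ]
  (∀ x y → (Adj G x y → CLAdj H φ (to σ x) (to σ y))
         × (CLAdj H φ (to σ x) (to σ y) → Adj G x y))
  where open Function.Bundles.Inverse

Proper2ColourLine : Graph → Set
Proper2ColourLine G =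
  Σ[ H ∈ Graph ] Σ[ φ ∈ (Edge H → Fin 2) ] (ProperColouring H φ × IsoCL G H φ)

-- The proof goes through good partitions: partitions of the vertex set into two cliques in which
-- every vertex has at most two neighbours on the other side.  The colour classes of CL(H, φ) form
-- one, as an edge meets at most one edge of the other colour at each of its two ends.  Conversely
-- a good partition is realised by the graph H whose vertices are the crossing edges of G together
-- with some spare vertices, a vertex x of G becoming the edge of H joining the crossing edges at x.
-- Good partitions pass to induced subgraphs, and K5-e, F₁, …, F₄ have none (a finite check).
-- Finally, let G be co-bipartite without induced K5-e.  Then a non-universal vertex has at most
-- two crossing neighbours, and at most one besides a universal vertex.  So the universal vertices
-- can be moved to one side, unless both sides contain three non-universal vertices and some
-- vertex u is universal; but then the crossing edges between the two triples form a matching,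
-- and together with u they induce one of F₁, …, F₄.

module Submission where

open import Defs hiding (sym)
open import Data.Bool using (Bool; true; false; not; _∧_; _∨_)
import Data.Bool as Bool
open import Data.Bool.Properties using (¬-not; not-injective)
open import Data.Nat using (ℕ; _*_; _<ᵇ_)
open import Data.Fin as Fin using (Fin; toℕ; combine; remQuot)
open import Data.Fin.Patterns
import Data.Fin.Properties as Finₚ
open import Data.Fin.Properties using (all?; any?; remQuot-combine; 2↔Bool)
open import Data.Fin.Permutation using (Permutation′; _⟨$⟩ʳ_; transpose; _∘ₚ_) renaming (id to idₚ)
open import Data.Fin.Subset.Properties using (anySubset?)
open import Data.Vec using (lookup; tabulate)
open import Data.Vec.Properties using (lookup∘tabulate)
open import Data.List using (List; []; _∷_)
open import Data.List.Relation.Unary.Any as Any using (Any; satisfied)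
open import Data.Product using (∃; ∃-syntax; _×_; _,_; proj₁; proj₂; uncurry)
open import Data.Sum using (_⊎_; inj₁; inj₂)
import Data.Sum
open import Data.Empty using (⊥; ⊥-elim)
open import Function using (_∘_)
open import Function.Bundles using (Injection; Inverse; Equivalence; _↔_; mk↔ₛ′; _⇔_; mk⇔)
open import Function.Construct.Symmetry using (↔-sym)
open import Function.Properties.Inverse using (↔⇒↣)
open import Relation.Nullary using (¬_; Dec; yes; no; ¬?; does)
open import Relation.Nullary.Decidable
  using (decidable-stable; _×-dec_; _⊎-dec_; _→-dec_; from-no; from-yes; map′; does-⇔; dec-true; dec-false)
open import Relation.Binary.Definitions using (tri<; tri≈; tri>)
open import Relation.Binary.PropositionalEquality
open import Axiom.UniquenessOfIdentityProofs using (module Decidable⇒UIP)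

Adj⇒≢ : (G : Graph) {x y : V G} → Adj G x y → x ≢ y
Adj⇒≢ G {x} xy refl with () ← trans (sym xy) (irrefl G x)

Adj-sym : (G : Graph) {x y : V G} → Adj G x y → Adj G y x
Adj-sym G {x} {y} = trans (Graph.sym G y x)

InducedSubgraph-trans : ∀ {F G K} → InducedSubgraph F G → InducedSubgraph G K → InducedSubgraph F K
InducedSubgraph-trans (f , f-inj , f-adj) (g , g-inj , g-adj) =
  g ∘ f , f-inj ∘ g-inj , λ x y → trans (f-adj x y) (g-adj (f x) (f y))

opposite⇒same : ∀ {a b c : Bool} → a ≢ b → a ≢ c → b ≡ c
opposite⇒same a≢b a≢c = trans (¬-not (≢-sym a≢b)) (sym (¬-not (≢-sym a≢c)))

witness : ∀ {A : Set} (a? : Dec A) → does a? ≡ true → A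
witness (yes a) _ = a

infix 4 _∈ₚ_

_∈ₚ_ : {A : Set} → A → A × A → Set
v ∈ₚ P = proj₁ P ≡ v ⊎ proj₂ P ≡ v

SamePair : {A : Set} → A × A → A × A → Set
SamePair P Q = (proj₁ P ≡ proj₁ Q × proj₂ P ≡ proj₂ Q) ⊎ (proj₁ P ≡ proj₂ Q × proj₂ P ≡ proj₁ Q)

SamePair-sym : {A : Set} {P Q : A × A} → SamePair P Q → SamePair Q P
SamePair-sym (inj₁ (p , q)) = inj₁ (sym p , sym q)
SamePair-sym (inj₂ (p , q)) = inj₂ (sym q , sym p)

SamePair-trans : {A : Set} {P Q R : A × A} → SamePair P Q → SamePair Q R → SamePair P R
SamePair-trans (inj₁ (p , q)) (inj₁ (p' , q')) = inj₁ (trans p p' , trans q q')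
SamePair-trans (inj₁ (p , q)) (inj₂ (p' , q')) = inj₂ (trans p p' , trans q q')
SamePair-trans (inj₂ (p , q)) (inj₁ (p' , q')) = inj₂ (trans p q' , trans q p')
SamePair-trans (inj₂ (p , q)) (inj₂ (p' , q')) = inj₁ (trans p q' , trans q p')

SamePair-swap : {A : Set} {P : A × A} {i j : A} → SamePair P (i , j) → SamePair P (j , i)
SamePair-swap (inj₁ pq) = inj₂ pq
SamePair-swap (inj₂ pq) = inj₁ pq

∈ₚ-resp-SamePair : {A : Set} {v : A} {P Q : A × A} → SamePair P Q → v ∈ₚ P → v ∈ₚ Q
∈ₚ-resp-SamePair (inj₁ (p , _)) (inj₁ refl) = inj₁ (sym p)
∈ₚ-resp-SamePair (inj₁ (_ , q)) (inj₂ refl) = inj₂ (sym q)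
∈ₚ-resp-SamePair (inj₂ (p , _)) (inj₁ refl) = inj₂ (sym p)
∈ₚ-resp-SamePair (inj₂ (_ , q)) (inj₂ refl) = inj₁ (sym q)

module _ (H : Graph) where

  endpoints : Edge H → V H × V H
  endpoints e = endpoint₁ H e , endpoint₂ H e

  Incident : V H → Edge H → Set
  Incident v e = v ∈ₚ endpoints e

  ShareEnd⇒incident : ∀ e f → ShareEnd {H} e f → Incident (endpoint₁ H e) f ⊎ Incident (endpoint₂ H e) f
  ShareEnd⇒incident e f (inj₁ p)               = inj₁ (inj₁ (sym p))
  ShareEnd⇒incident e f (inj₂ (inj₁ p))        = inj₁ (inj₂ (sym p))
  ShareEnd⇒incident e f (inj₂ (inj₂ (inj₁ p))) = inj₂ (inj₁ (sym p))
  ShareEnd⇒incident e f (inj₂ (inj₂ (inj₂ p))) = inj₂ (inj₂ (sym p))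

  ShareEnd⇒common : ∀ e f → ShareEnd {H} e f → ∃[ v ] Incident v e × Incident v f
  ShareEnd⇒common e f share with ShareEnd⇒incident e f share
  ... | inj₁ incident = endpoint₁ H e , inj₁ refl , incident
  ... | inj₂ incident = endpoint₂ H e , inj₂ refl , incident

  common⇒ShareEnd : ∀ e f {v} → Incident v e → Incident v f → ShareEnd {H} e f
  common⇒ShareEnd e f (inj₁ p) (inj₁ q) = inj₁ (trans p (sym q))
  common⇒ShareEnd e f (inj₁ p) (inj₂ q) = inj₂ (inj₁ (trans p (sym q)))
  common⇒ShareEnd e f (inj₂ p) (inj₁ q) = inj₂ (inj₂ (inj₁ (trans p (sym q))))
  common⇒ShareEnd e f (inj₂ p) (inj₂ q) = inj₂ (inj₂ (inj₂ (trans p (sym q))))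

-- Good partitions

CliquePartition : (G : Graph) → (V G → Bool) → Set
CliquePartition G s = ∀ x y → x ≢ y → s x ≡ s y → Adj G x y

record Crossing (G : Graph) (s : V G → Bool) (x y : V G) : Set where
  constructor crossing
  field
    opposite : s x ≢ s y
    adjacent : Adj G x y
open Crossing public

AtMostTwoCrossings : (G : Graph) → (V G → Bool) → Set
AtMostTwoCrossings G s = ∀ x y₁ y₂ y₃ → y₁ ≢ y₂ → y₁ ≢ y₃ → y₂ ≢ y₃ →
  Crossing G s x y₁ → Crossing G s x y₂ → Crossing G s x y₃ → ⊥

IsGoodPartition : (G : Graph) → (V G → Bool) → Set
IsGoodPartition G s = CliquePartition G s × AtMostTwoCrossings G s

GoodPartition : Graph → Set
GoodPartition G = ∃ (IsGoodPartition G)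

Crossing-sym : ∀ {G s x y} → Crossing G s x y → Crossing G s y x
Crossing-sym {G} (crossing sx≢sy xy) = crossing (≢-sym sx≢sy) (Adj-sym G xy)

crossing? : (G : Graph) (s : V G → Bool) → ∀ x y → Dec (Crossing G s x y)
crossing? G s x y = map′ (uncurry crossing) (λ c → opposite c , adjacent c)
  (¬? (s x Bool.≟ s y) ×-dec (adj G x y Bool.≟ true))

isGoodPartition? : (G : Graph) (s : V G → Bool) → Dec (IsGoodPartition G s)
isGoodPartition? G s = cliques? ×-dec sparse?
  where
    cliques? = all? λ x → all? λ y →
      ¬? (x Fin.≟ y) →-dec (s x Bool.≟ s y) →-dec (adj G x y Bool.≟ true)
    sparse? = all? λ x → all? λ y₁ → all? λ y₂ → all? λ y₃ →
      ¬? (y₁ Fin.≟ y₂) →-dec ¬? (y₁ Fin.≟ y₃) →-dec ¬? (y₂ Fin.≟ y₃) →-dec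
      crossing? G s x y₁ →-dec crossing? G s x y₂ →-dec crossing? G s x y₃ →-dec no λ ()

IsGoodPartition-resp : (G : Graph) {s t : V G → Bool} → s ≗ t → IsGoodPartition G s → IsGoodPartition G t
IsGoodPartition-resp G {s} {t} s≗t (cliques , sparse) =
  (λ x y x≢y tx≡ty → cliques x y x≢y (trans (s≗t x) (trans tx≡ty (sym (s≗t y))))) ,
  λ x y₁ y₂ y₃ d₁₂ d₁₃ d₂₃ c₁ c₂ c₃ → sparse x y₁ y₂ y₃ d₁₂ d₁₃ d₂₃ (back c₁) (back c₂) (back c₃)
  where
    back : ∀ {x y} → Crossing G t x y → Crossing G s x y
    back {x} {y} (crossing tx≢ty xy) = crossing (λ sx≡sy → tx≢ty (trans (sym (s≗t x)) (trans sx≡sy (s≗t y)))) xy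

anyFunction? : ∀ {n} {P : (Fin n → Bool) → Set} →
  (∀ {f g} → f ≗ g → P f → P g) → (∀ f → Dec (P f)) → Dec (∃ P)
anyFunction? resp P? = map′ (λ (v , p) → lookup v , p)
  (λ (f , p) → tabulate f , resp (λ i → sym (lookup∘tabulate f i)) p)
  (anySubset? (P? ∘ lookup))

allFunctions? : ∀ {n} {P : (Fin n → Bool) → Set} →
  (∀ {f g} → f ≗ g → P f → P g) → (∀ f → Dec (P f)) → Dec (∀ f → P f)
allFunctions? resp P? =
  map′ (λ ¬cex f → decidable-stable (P? f) λ ¬pf → ¬cex (f , ¬pf)) (λ all (f , ¬pf) → ¬pf (all f))
       (¬? (anyFunction? (λ f≗g ¬pf pg → ¬pf (resp (sym ∘ f≗g) pg)) (¬? ∘ P?)))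

goodPartition? : (G : Graph) → Dec (GoodPartition G)
goodPartition? G = anyFunction? (IsGoodPartition-resp G) (isGoodPartition? G)

GoodPartition-induced : ∀ {F G} → InducedSubgraph F G → GoodPartition G → GoodPartition F
GoodPartition-induced {F} {G} (f , f-inj , f-adj) (s , cliques , sparse) =
  s ∘ f ,
  (λ x y x≢y sx≡sy → pull (cliques (f x) (f y) (x≢y ∘ f-inj) sx≡sy)) ,
  λ x y₁ y₂ y₃ d₁₂ d₁₃ d₂₃ c₁ c₂ c₃ →
    sparse (f x) (f y₁) (f y₂) (f y₃) (d₁₂ ∘ f-inj) (d₁₃ ∘ f-inj) (d₂₃ ∘ f-inj) (push c₁) (push c₂) (push c₃)
  where
    pull : ∀ {x y} → Adj G (f x) (f y) → Adj F x y
    pull = trans (f-adj _ _)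
    push : ∀ {x y} → Crossing F (s ∘ f) x y → Crossing G s (f x) (f y)
    push (crossing opposite xy) = crossing opposite (trans (sym (f-adj _ _)) xy)

-- A proper 2-colour-line graph has a good partition

sideOf : Fin 2 → Bool
sideOf = Inverse.to 2↔Bool

sideOf-injective : ∀ {c c'} → sideOf c ≡ sideOf c' → c ≡ c'
sideOf-injective = Injection.injective (↔⇒↣ 2↔Bool)

colourOf : Bool → Fin 2
colourOf = Inverse.from 2↔Bool

colourOf-injective : ∀ {β β'} → colourOf β ≡ colourOf β' → β ≡ β'
colourOf-injective = Injection.injective (↔⇒↣ (↔-sym 2↔Bool))

module ColourClasses (G H : Graph) (φ : Edge H → Fin 2) (proper : ProperColouring H φ) (iso : IsoCL G H φ) where

  edge : V G → Edge H
  edge = Inverse.to (proj₁ iso)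

  edge-injective : ∀ {x y} → edge x ≡ edge y → x ≡ y
  edge-injective = Injection.injective (↔⇒↣ (proj₁ iso))

  side : V G → Bool
  side x = sideOf (φ (edge x))

  cliques : CliquePartition G side
  cliques x y x≢y same = proj₂ (proj₂ iso x y) (x≢y ∘ edge-injective , inj₂ (sideOf-injective same))

  crossing⇒ShareEnd : ∀ x y → Crossing G side x y → ShareEnd {H} (edge x) (edge y)
  crossing⇒ShareEnd x y (crossing opposite xy) with proj₁ (proj₂ iso x y) xy
  ... | _ , inj₁ share      = share
  ... | _ , inj₂ sameColour = ⊥-elim (opposite (cong sideOf sameColour))

  -- The two edges would be distinct, share the endvertex v and have the same colour.
  crossingsAtSameEnd : ∀ {x} y₁ y₂ {v} → y₁ ≢ y₂ → Crossing G side x y₁ → Crossing G side x y₂ →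
    Incident H v (edge y₁) → Incident H v (edge y₂) → ⊥
  crossingsAtSameEnd y₁ y₂ y₁≢y₂ c₁ c₂ v₁ v₂ =
    proper (edge y₁) (edge y₂) (y₁≢y₂ ∘ edge-injective) (common⇒ShareEnd H (edge y₁) (edge y₂) v₁ v₂)
      (sideOf-injective (opposite⇒same (opposite c₁) (opposite c₂)))

  -- Each of the three crossing edges meets one of the two ends of edge x.
  atMostTwoCrossings : AtMostTwoCrossings G side
  atMostTwoCrossings x y₁ y₂ y₃ d₁₂ d₁₃ d₂₃ c₁ c₂ c₃
    with ShareEnd⇒incident H (edge x) (edge y₁) (crossing⇒ShareEnd x y₁ c₁)
       | ShareEnd⇒incident H (edge x) (edge y₂) (crossing⇒ShareEnd x y₂ c₂)
       | ShareEnd⇒incident H (edge x) (edge y₃) (crossing⇒ShareEnd x y₃ c₃)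
  ... | inj₁ i₁ | inj₁ i₂ | _       = crossingsAtSameEnd y₁ y₂ d₁₂ c₁ c₂ i₁ i₂
  ... | inj₂ i₁ | inj₂ i₂ | _       = crossingsAtSameEnd y₁ y₂ d₁₂ c₁ c₂ i₁ i₂
  ... | inj₁ i₁ | inj₂ _  | inj₁ i₃ = crossingsAtSameEnd y₁ y₃ d₁₃ c₁ c₃ i₁ i₃
  ... | inj₁ _  | inj₂ i₂ | inj₂ i₃ = crossingsAtSameEnd y₂ y₃ d₂₃ c₂ c₃ i₂ i₃
  ... | inj₂ _  | inj₁ i₂ | inj₁ i₃ = crossingsAtSameEnd y₂ y₃ d₂₃ c₂ c₃ i₂ i₃
  ... | inj₂ i₁ | inj₁ _  | inj₂ i₃ = crossingsAtSameEnd y₁ y₃ d₁₃ c₁ c₃ i₁ i₃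

proper2ColourLine⇒goodPartition : (G : Graph) → Proper2ColourLine G → GoodPartition G
proper2ColourLine⇒goodPartition G (H , φ , proper , iso) = side , cliques , atMostTwoCrossings
  where open ColourClasses G H φ proper iso

-- The forbidden graphs

K5-e-noGoodPartition : ¬ GoodPartition K5-e
K5-e-noGoodPartition = from-no (goodPartition? K5-e)

Forbidden : Fin 4 → Graph
Forbidden 0F = F₁
Forbidden 1F = F₂
Forbidden 2F = F₃
Forbidden 3F = F₄

Forbidden-noGoodPartition : ∀ k → ¬ GoodPartition (Forbidden k)
Forbidden-noGoodPartition 0F = from-no (goodPartition? F₁)
Forbidden-noGoodPartition 1F = from-no (goodPartition? F₂)
Forbidden-noGoodPartition 2F = from-no (goodPartition? F₃)
Forbidden-noGoodPartition 3F = from-no (goodPartition? F₄)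

-- Two triangles {a₀,a₁,a₂}, {b₀,b₁,b₂} and a vertex u adjacent to all of them, with aᵢ ~ bⱼ
-- prescribed by a matrix; the vertices are numbered as in F₁, …, F₄.
data Role : Set where
  a b : Fin 3 → Role
  u   : Role

a-injective : ∀ {i j} → a i ≡ a j → i ≡ j
a-injective refl = refl

b-injective : ∀ {i j} → b i ≡ b j → i ≡ j
b-injective refl = refl

role : Fin 7 → Role
role 0F = a 0F
role 1F = a 1F
role 2F = a 2F
role 3F = b 0F
role 4F = b 1F
role 5F = b 2F
role 6F = u

vertex : Role → Fin 7
vertex (a 0F) = 0F
vertex (a 1F) = 1F
vertex (a 2F) = 2F
vertex (b 0F) = 3F
vertex (b 1F) = 4F
vertex (b 2F) = 5F
vertex u      = 6F

vertex-role : ∀ x → vertex (role x) ≡ x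
vertex-role 0F = refl
vertex-role 1F = refl
vertex-role 2F = refl
vertex-role 3F = refl
vertex-role 4F = refl
vertex-role 5F = refl
vertex-role 6F = refl

role-vertex : ∀ r → role (vertex r) ≡ r
role-vertex (a 0F) = refl
role-vertex (a 1F) = refl
role-vertex (a 2F) = refl
role-vertex (b 0F) = refl
role-vertex (b 1F) = refl
role-vertex (b 2F) = refl
role-vertex u      = refl

role-injective : ∀ {x y} → role x ≡ role y → x ≡ y
role-injective {x} {y} eq = trans (sym (vertex-role x)) (trans (cong vertex eq) (vertex-role y))

Matrix : Set
Matrix = Fin 3 → Fin 3 → Bool

_≐_ : Matrix → Matrix → Set
c ≐ d = ∀ i j → c i j ≡ d i j

roleAdj : Matrix → Role → Role → Bool
roleAdj c (a i) (a j) = not (does (i Fin.≟ j))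
roleAdj c (b i) (b j) = not (does (i Fin.≟ j))
roleAdj c (a i) (b j) = c i j
roleAdj c (b j) (a i) = c i j
roleAdj c u     u     = false
roleAdj c u     _     = true
roleAdj c _     u     = true

roleAdj-sym : ∀ c r r' → roleAdj c r r' ≡ roleAdj c r' r
roleAdj-sym c (a i) (a j) = cong not (does-⇔ (mk⇔ sym sym) (i Fin.≟ j) (j Fin.≟ i))
roleAdj-sym c (b i) (b j) = cong not (does-⇔ (mk⇔ sym sym) (i Fin.≟ j) (j Fin.≟ i))
roleAdj-sym c (a _) (b _) = refl
roleAdj-sym c (b _) (a _) = refl
roleAdj-sym c (a _) u     = refl
roleAdj-sym c (b _) u     = refl
roleAdj-sym c u     (a _) = refl
roleAdj-sym c u     (b _) = refl
roleAdj-sym c u     u     = refl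

roleAdj-irrefl : ∀ c r → roleAdj c r r ≡ false
roleAdj-irrefl c (a i) = cong not (dec-true (i Fin.≟ i) refl)
roleAdj-irrefl c (b i) = cong not (dec-true (i Fin.≟ i) refl)
roleAdj-irrefl c u     = refl

Pattern : Matrix → Graph
Pattern c = record
  { n      = 7
  ; adj    = λ x y → roleAdj c (role x) (role y)
  ; sym    = λ x y → roleAdj-sym c (role x) (role y)
  ; irrefl = λ x → roleAdj-irrefl c (role x)
  }

Pattern-embedding : ∀ {c} (G : Graph) (place : Role → V G) → (∀ {r r'} → place r ≡ place r' → r ≡ r') →
  (∀ r r' → roleAdj c r r' ≡ adj G (place r) (place r')) → InducedSubgraph (Pattern c) G
Pattern-embedding G place place-injective place-adj =
  place ∘ role , role-injective ∘ place-injective , λ x y → place-adj (role x) (role y)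

-- F_(k+1) is the pattern whose cross edges are a₀b₀, …, a_(k-1)b_(k-1).
diagonal : Fin 4 → Matrix
diagonal k i j = does (i Fin.≟ j) ∧ (toℕ i <ᵇ toℕ k)

agreement? : ∀ {m} (f g : Fin m → Fin m → Bool) → Dec (∀ x y → f x y ≡ g x y)
agreement? f g = all? λ x → all? λ y → f x y Bool.≟ g x y

Forbidden-pattern : ∀ k → InducedSubgraph (Forbidden k) (Pattern (diagonal k))
Forbidden-pattern 0F = (λ x → x) , (λ p → p) , from-yes (agreement? (adj F₁) (adj (Pattern (diagonal 0F))))
Forbidden-pattern 1F = (λ x → x) , (λ p → p) , from-yes (agreement? (adj F₂) (adj (Pattern (diagonal 1F))))
Forbidden-pattern 2F = (λ x → x) , (λ p → p) , from-yes (agreement? (adj F₃) (adj (Pattern (diagonal 2F))))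
Forbidden-pattern 3F = (λ x → x) , (λ p → p) , from-yes (agreement? (adj F₄) (adj (Pattern (diagonal 3F))))

RelabelsTo : Matrix → Matrix → Permutation′ 3 → Permutation′ 3 → Set
RelabelsTo c d π ρ = ∀ i j → c (π ⟨$⟩ʳ i) (ρ ⟨$⟩ʳ j) ≡ d i j

permute-injective : ∀ (π : Permutation′ 3) {i j} → π ⟨$⟩ʳ i ≡ π ⟨$⟩ʳ j → i ≡ j
permute-injective π = Injection.injective (↔⇒↣ π)

module _ (π ρ : Permutation′ 3) where

  relabel : Role → Role
  relabel (a i) = a (π ⟨$⟩ʳ i)
  relabel (b j) = b (ρ ⟨$⟩ʳ j)
  relabel u     = u

  relabel-injective : ∀ {r r'} → relabel r ≡ relabel r' → r ≡ r'
  relabel-injective {a _} {a _} eq with refl ← permute-injective π (a-injective eq) = refl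
  relabel-injective {b _} {b _} eq with refl ← permute-injective ρ (b-injective eq) = refl
  relabel-injective {u}   {u}   _  = refl
  relabel-injective {a _} {b _} ()
  relabel-injective {a _} {u}   ()
  relabel-injective {b _} {a _} ()
  relabel-injective {b _} {u}   ()
  relabel-injective {u}   {a _} ()
  relabel-injective {u}   {b _} ()

  roleAdj-relabel : ∀ {c d} → RelabelsTo c d π ρ → ∀ r r' → roleAdj d r r' ≡ roleAdj c (relabel r) (relabel r')
  roleAdj-relabel _ (a i) (a j) =
    cong not (does-⇔ (mk⇔ (cong (π ⟨$⟩ʳ_)) (permute-injective π)) (i Fin.≟ j) (π ⟨$⟩ʳ i Fin.≟ π ⟨$⟩ʳ j))
  roleAdj-relabel _ (b i) (b j) =
    cong not (does-⇔ (mk⇔ (cong (ρ ⟨$⟩ʳ_)) (permute-injective ρ)) (i Fin.≟ j) (ρ ⟨$⟩ʳ i Fin.≟ ρ ⟨$⟩ʳ j))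
  roleAdj-relabel relabels (a i) (b j) = sym (relabels i j)
  roleAdj-relabel relabels (b j) (a i) = sym (relabels i j)
  roleAdj-relabel _ (a _) u     = refl
  roleAdj-relabel _ (b _) u     = refl
  roleAdj-relabel _ u     (a _) = refl
  roleAdj-relabel _ u     (b _) = refl
  roleAdj-relabel _ u     u     = refl

  Pattern-relabel : ∀ {c d} → RelabelsTo c d π ρ → InducedSubgraph (Pattern d) (Pattern c)
  Pattern-relabel {c} {d} relabels = Pattern-embedding {d} (Pattern c) (vertex ∘ relabel)
    (relabel-injective ∘ cong-role)
    λ r r' → trans (roleAdj-relabel relabels r r') (sym (cong₂ (roleAdj c) (role-vertex (relabel r)) (role-vertex (relabel r'))))
    where
      cong-role : ∀ {r r'} → vertex (relabel r) ≡ vertex (relabel r') → relabel r ≡ relabel r'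
      cong-role {r} {r'} eq = trans (sym (role-vertex (relabel r))) (trans (cong role eq) (role-vertex (relabel r')))

Matching : Matrix → Set
Matching c = (∀ i j j' → j ≢ j' → c i j ≡ true → c i j' ≡ true → ⊥)
           × (∀ i i' j → i ≢ i' → c i j ≡ true → c i' j ≡ true → ⊥)

matching? : ∀ c → Dec (Matching c)
matching? c =
  (all? λ i → all? λ j → all? λ j' →
     ¬? (j Fin.≟ j') →-dec (c i j Bool.≟ true) →-dec (c i j' Bool.≟ true) →-dec no λ ())
  ×-dec
  (all? λ i → all? λ i' → all? λ j →
     ¬? (i Fin.≟ i') →-dec (c i j Bool.≟ true) →-dec (c i' j Bool.≟ true) →-dec no λ ())

Matching-resp : ∀ {c d} → c ≐ d → Matching c → Matching d
Matching-resp c≐d (rows , columns) =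
  (λ i j j' j≢j' dij dij' → rows i j j' j≢j' (trans (c≐d i j) dij) (trans (c≐d i j') dij')) ,
  (λ i i' j i≢i' dij di'j → columns i i' j i≢i' (trans (c≐d i j) dij) (trans (c≐d i' j) di'j))

permutations₃ : List (Permutation′ 3)
permutations₃ = idₚ ∷ transpose 0F 1F ∷ transpose 0F 2F ∷ transpose 1F 2F
              ∷ transpose 0F 1F ∘ₚ transpose 1F 2F ∷ transpose 1F 2F ∘ₚ transpose 0F 1F ∷ []

-- The permutations range over an explicit list of all six, so that this is decidable.
Diagonalisable : Matrix → Set
Diagonalisable c = ∃[ k ] Any (λ π → Any (λ ρ → RelabelsTo c (diagonal k) π ρ) permutations₃) permutations₃

diagonalisable? : ∀ c → Dec (Diagonalisable c)
diagonalisable? c = any? λ k → Any.any? (λ π → Any.any? (relabelsTo? k π) permutations₃) permutations₃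
  where
    relabelsTo? : ∀ k π ρ → Dec (RelabelsTo c (diagonal k) π ρ)
    relabelsTo? k π ρ = agreement? (λ i j → c (π ⟨$⟩ʳ i) (ρ ⟨$⟩ʳ j)) (diagonal k)

Diagonalisable-resp : ∀ {c d} → c ≐ d → Diagonalisable c → Diagonalisable d
Diagonalisable-resp c≐d (k , permutes) =
  k , Any.map (Any.map λ relabels i j → trans (sym (c≐d _ _)) (relabels i j)) permutes

-- Checked over all 2⁹ matrices, coded as functions on Fin 9 = Fin 3 × Fin 3.
matching⇒diagonalisable : ∀ c → Matching c → Diagonalisable c
matching⇒diagonalisable c =
  Diagonalisable-resp decode-code ∘ checked (uncurry c ∘ remQuot 3) ∘ Matching-resp (λ i j → sym (decode-code i j))
  where
    decode : (Fin 9 → Bool) → Matrix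
    decode f i j = f (combine i j)
    decode-code : decode (uncurry c ∘ remQuot 3) ≐ c
    decode-code i j = cong (uncurry c) (remQuot-combine i j)
    checked : ∀ f → Matching (decode f) → Diagonalisable (decode f)
    checked = from-yes (allFunctions?
      (λ f≗g check → Diagonalisable-resp (λ i j → f≗g (combine i j))
                     ∘ check ∘ Matching-resp (λ i j → sym (f≗g (combine i j))))
      (λ f → matching? (decode f) →-dec diagonalisable? (decode f)))

matching⇒Forbidden : ∀ c → Matching c → ∃[ k ] InducedSubgraph (Forbidden k) (Pattern c)
matching⇒Forbidden c = embed ∘ matching⇒diagonalisable c
  where
    embed : Diagonalisable c → ∃[ k ] InducedSubgraph (Forbidden k) (Pattern c)
    embed (k , permutes) =
      let π , permutesρ = satisfied permutes
          ρ , relabels  = satisfied permutesρ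
      in k , InducedSubgraph-trans {Forbidden k} {Pattern (diagonal k)} {Pattern c}
               (Forbidden-pattern k) (Pattern-relabel π ρ {c} relabels)

-- Excluding the forbidden graphs yields a good partition

Universal : (G : Graph) → V G → Set
Universal G x = ∀ y → y ≢ x → Adj G x y

-- Opaque, so that `with universal? G x` can abstract it out of `does (universal? G x) ∨ s x`.
opaque
  universal? : (G : Graph) → ∀ x → Dec (Universal G x)
  universal? G x = all? λ y → ¬? (y Fin.≟ x) →-dec (adj G x y Bool.≟ true)

NonNeighbour : (G : Graph) → V G → V G → Set
NonNeighbour G x z = z ≢ x × adj G x z ≡ false

nonUniversal⇒nonNeighbour : (G : Graph) {x : V G} → ¬ Universal G x → ∃ (NonNeighbour G x)
nonUniversal⇒nonNeighbour G {x} nonUniversal =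
  decidable-stable (any? λ z → ¬? (z Fin.≟ x) ×-dec (adj G x z Bool.≟ false))
    λ noNonNeighbour → nonUniversal λ y y≢x → ¬-not (λ xy → noNonNeighbour (y , y≢x , xy))

universal≢nonUniversal : (G : Graph) {w x : V G} → Universal G w → ¬ Universal G x → x ≢ w
universal≢nonUniversal G universal nonUniversal refl = nonUniversal universal

K5-e-nonEdges : ∀ i j → i ≢ j → adj K5-e i j ≡ false → (i ≡ 0F × j ≡ 1F) ⊎ (i ≡ 1F × j ≡ 0F)
K5-e-nonEdges = from-yes (all? λ i → all? λ j →
  ¬? (i Fin.≟ j) →-dec (adj K5-e i j Bool.≟ false) →-dec
  ((i Fin.≟ 0F ×-dec j Fin.≟ 1F) ⊎-dec (i Fin.≟ 1F ×-dec j Fin.≟ 0F)))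

K5-e-embedding : (G : Graph) {v₀ v₁ v₂ v₃ v₄ : V G} → v₀ ≢ v₁ → adj G v₀ v₁ ≡ false →
  Adj G v₀ v₂ → Adj G v₀ v₃ → Adj G v₀ v₄ → Adj G v₁ v₂ → Adj G v₁ v₃ → Adj G v₁ v₄ →
  Adj G v₂ v₃ → Adj G v₂ v₄ → Adj G v₃ v₄ → InducedSubgraph K5-e G
K5-e-embedding G {v₀} {v₁} {v₂} {v₃} {v₄} v₀≢v₁ v₀≁v₁ v₀v₂ v₀v₃ v₀v₄ v₁v₂ v₁v₃ v₁v₄ v₂v₃ v₂v₄ v₃v₄ =
  f , injective , adjacency
  where
    f : Fin 5 → V G
    f 0F = v₀
    f 1F = v₁
    f 2F = v₂
    f 3F = v₃
    f 4F = v₄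
    adjacency : ∀ i j → adj K5-e i j ≡ adj G (f i) (f j)
    adjacency 0F 0F = sym (irrefl G v₀)
    adjacency 0F 1F = sym v₀≁v₁
    adjacency 0F 2F = sym v₀v₂
    adjacency 0F 3F = sym v₀v₃
    adjacency 0F 4F = sym v₀v₄
    adjacency 1F 1F = sym (irrefl G v₁)
    adjacency 1F 2F = sym v₁v₂
    adjacency 1F 3F = sym v₁v₃
    adjacency 1F 4F = sym v₁v₄
    adjacency 2F 2F = sym (irrefl G v₂)
    adjacency 2F 3F = sym v₂v₃
    adjacency 2F 4F = sym v₂v₄
    adjacency 3F 3F = sym (irrefl G v₃)
    adjacency 3F 4F = sym v₃v₄
    adjacency 4F 4F = sym (irrefl G v₄)
    adjacency 1F 0F = sym (trans (Graph.sym G v₁ v₀) v₀≁v₁)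
    adjacency 2F 0F = sym (Adj-sym G v₀v₂)
    adjacency 3F 0F = sym (Adj-sym G v₀v₃)
    adjacency 4F 0F = sym (Adj-sym G v₀v₄)
    adjacency 2F 1F = sym (Adj-sym G v₁v₂)
    adjacency 3F 1F = sym (Adj-sym G v₁v₃)
    adjacency 4F 1F = sym (Adj-sym G v₁v₄)
    adjacency 3F 2F = sym (Adj-sym G v₂v₃)
    adjacency 4F 2F = sym (Adj-sym G v₂v₄)
    adjacency 4F 3F = sym (Adj-sym G v₃v₄)
    injective : ∀ {i j} → f i ≡ f j → i ≡ j
    injective {i} {j} fi≡fj with i Fin.≟ j
    ... | yes i≡j = i≡j
    ... | no i≢j with K5-e-nonEdges i j i≢j (¬-not λ ij → Adj⇒≢ G (trans (sym (adjacency i j)) ij) fi≡fj)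
    ...   | inj₁ (refl , refl) = ⊥-elim (v₀≢v₁ fi≡fj)
    ...   | inj₂ (refl , refl) = ⊥-elim (v₀≢v₁ (sym fi≡fj))

module K5-eFree (G : Graph) (noK5-e : ¬ InducedSubgraph K5-e G) {s : V G → Bool} (cliques : CliquePartition G s) where

  nonNeighbour-crossing : ∀ {x y z} → NonNeighbour G x z → Crossing G s x y → Adj G z y
  nonNeighbour-crossing {x} {y} {z} (z≢x , x≁z) (crossing sx≢sy xy) =
    cliques z y z≢y (opposite⇒same (λ sx≡sz → x≁z⇒⊥ (cliques x z (≢-sym z≢x) sx≡sz)) sx≢sy)
    where
      x≁z⇒⊥ : ¬ Adj G x z
      x≁z⇒⊥ xz with () ← trans (sym x≁z) xz
      z≢y : z ≢ y
      z≢y refl = x≁z⇒⊥ xy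

  -- x, z, y₁, y₂, w induce K5-e with missing edge xz.
  crossingsWithCommonNeighbour : ∀ {x z y₁ y₂ w} → NonNeighbour G x z → y₁ ≢ y₂ →
    Crossing G s x y₁ → Crossing G s x y₂ → Adj G x w → Adj G z w → Adj G y₁ w → Adj G y₂ w → ⊥
  crossingsWithCommonNeighbour nonNeighbour@(z≢x , x≁z) y₁≢y₂ c₁ c₂ xw zw y₁w y₂w =
    noK5-e (K5-e-embedding G (≢-sym z≢x) x≁z (adjacent c₁) (adjacent c₂) xw
      (nonNeighbour-crossing nonNeighbour c₁) (nonNeighbour-crossing nonNeighbour c₂) zw
      (cliques _ _ y₁≢y₂ (opposite⇒same (opposite c₁) (opposite c₂))) y₁w y₂w)

  nonUniversal⇒atMostTwoCrossings : ∀ {x} → ¬ Universal G x → ∀ y₁ y₂ y₃ → y₁ ≢ y₂ → y₁ ≢ y₃ → y₂ ≢ y₃ →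
    Crossing G s x y₁ → Crossing G s x y₂ → Crossing G s x y₃ → ⊥
  nonUniversal⇒atMostTwoCrossings nonUniversal y₁ y₂ y₃ d₁₂ d₁₃ d₂₃ c₁ c₂ c₃ =
    crossingsWithCommonNeighbour nonNeighbour d₁₂ c₁ c₂ (adjacent c₃) (nonNeighbour-crossing nonNeighbour c₃)
      (cliques y₁ y₃ d₁₃ (opposite⇒same (opposite c₁) (opposite c₃)))
      (cliques y₂ y₃ d₂₃ (opposite⇒same (opposite c₂) (opposite c₃)))
    where nonNeighbour = proj₂ (nonUniversal⇒nonNeighbour G nonUniversal)

  nonUniversal⇒oneCrossingBesidesUniversal : ∀ {w x y₁ y₂} → Universal G w → ¬ Universal G x →
    y₁ ≢ y₂ → y₁ ≢ w → y₂ ≢ w → Crossing G s x y₁ → Crossing G s x y₂ → ⊥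
  nonUniversal⇒oneCrossingBesidesUniversal {w} {x} universal nonUniversal y₁≢y₂ y₁≢w y₂≢w c₁ c₂ =
    crossingsWithCommonNeighbour nonNeighbour y₁≢y₂ c₁ c₂ (toUniversal (universal≢nonUniversal G universal nonUniversal))
      (toUniversal z≢w) (toUniversal y₁≢w) (toUniversal y₂≢w)
    where
      z = proj₁ (nonUniversal⇒nonNeighbour G nonUniversal)
      nonNeighbour = proj₂ (nonUniversal⇒nonNeighbour G nonUniversal)
      toUniversal : ∀ {y} → y ≢ w → Adj G y w
      toUniversal y≢w = Adj-sym G (universal _ y≢w)
      z≢w : z ≢ w
      z≢w refl with () ← trans (sym (proj₂ nonNeighbour)) (toUniversal (universal≢nonUniversal G universal nonUniversal))

module GoodRepartition (G : Graph) (noK5-e : ¬ InducedSubgraph K5-e G) where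

  NonUniversalOnFalse : (V G → Bool) → V G → Set
  NonUniversalOnFalse side y = ¬ Universal G y × side y ≡ false

  record NonUniversalTriple (side : V G → Bool) : Set where
    field
      at           : Fin 3 → V G
      at-injective : ∀ {i j} → at i ≡ at j → i ≡ j
      at-onFalse    : ∀ i → NonUniversalOnFalse side (at i)

  NoNonUniversalTriple : (V G → Bool) → Set
  NoNonUniversalTriple side = ∀ y₁ y₂ y₃ → y₁ ≢ y₂ → y₁ ≢ y₃ → y₂ ≢ y₃ →
    NonUniversalOnFalse side y₁ → NonUniversalOnFalse side y₂ → NonUniversalOnFalse side y₃ → ⊥

  nonUniversalOnFalse? : ∀ side y → Dec (NonUniversalOnFalse side y)
  nonUniversalOnFalse? side y = ¬? (universal? G y) ×-dec (side y Bool.≟ false)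

  nonUniversalTriple? : ∀ side → NonUniversalTriple side ⊎ NoNonUniversalTriple side
  nonUniversalTriple? side with any? (λ y₁ → any? λ y₂ → any? λ y₃ →
    ¬? (y₁ Fin.≟ y₂) ×-dec ¬? (y₁ Fin.≟ y₃) ×-dec ¬? (y₂ Fin.≟ y₃) ×-dec
    nonUniversalOnFalse? side y₁ ×-dec nonUniversalOnFalse? side y₂ ×-dec nonUniversalOnFalse? side y₃)
  ... | yes (y₁ , y₂ , y₃ , d₁₂ , d₁₃ , d₂₃ , o₁ , o₂ , o₃) = inj₁ record
    { at = at ; at-injective = at-injective ; at-onFalse = λ { 0F → o₁ ; 1F → o₂ ; 2F → o₃ } }
    where
      at : Fin 3 → V G
      at 0F = y₁
      at 1F = y₂
      at 2F = y₃
      at-injective : ∀ {i j} → at i ≡ at j → i ≡ j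
      at-injective {0F} {0F} _ = refl
      at-injective {1F} {1F} _ = refl
      at-injective {2F} {2F} _ = refl
      at-injective {0F} {1F} e = ⊥-elim (d₁₂ e)
      at-injective {0F} {2F} e = ⊥-elim (d₁₃ e)
      at-injective {1F} {2F} e = ⊥-elim (d₂₃ e)
      at-injective {1F} {0F} e = ⊥-elim (d₁₂ (sym e))
      at-injective {2F} {0F} e = ⊥-elim (d₁₃ (sym e))
      at-injective {2F} {1F} e = ⊥-elim (d₂₃ (sym e))
  ... | no noTriple = inj₂ λ y₁ y₂ y₃ d₁₂ d₁₃ d₂₃ o₁ o₂ o₃ →
    noTriple (y₁ , y₂ , y₃ , d₁₂ , d₁₃ , d₂₃ , o₁ , o₂ , o₃)

  -- Putting every universal vertex on side true keeps both sides cliques, and then only a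
  -- universal vertex could have three crossings, to three non-universal vertices on side false.
  module MoveUniversals {s : V G → Bool} (cliques : CliquePartition G s) (noTriple : NoNonUniversalTriple s) where

    side : V G → Bool
    side x = does (universal? G x) ∨ s x

    side-cliques : CliquePartition G side
    side-cliques x y x≢y same with universal? G x | universal? G y
    ... | yes universal | _        = universal y (≢-sym x≢y)
    ... | no _ | yes universal     = Adj-sym G (universal x x≢y)
    ... | no _ | no _              = cliques x y x≢y same

    side≡false⇒nonUniversalOnFalse : ∀ {y} → side y ≡ false → NonUniversalOnFalse s y
    side≡false⇒nonUniversalOnFalse {y} sy≡false with universal? G y
    ... | no nonUniversal = nonUniversal , sy≡false

    side-sparse : AtMostTwoCrossings G side
    side-sparse x y₁ y₂ y₃ d₁₂ d₁₃ d₂₃ c₁ c₂ c₃ with universal? G x in eq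
    ... | no nonUniversal =
      K5-eFree.nonUniversal⇒atMostTwoCrossings G noK5-e side-cliques nonUniversal y₁ y₂ y₃ d₁₂ d₁₃ d₂₃ c₁ c₂ c₃
    ... | yes _ = noTriple y₁ y₂ y₃ d₁₂ d₁₃ d₂₃ (crossed c₁) (crossed c₂) (crossed c₃)
      where
        crossed : ∀ {y} → Crossing G side x y → NonUniversalOnFalse s y
        crossed c = side≡false⇒nonUniversalOnFalse
          (¬-not (≢-sym (subst (_≢ side _) (cong (λ d → does d ∨ s x) eq) (opposite c))))

    goodPartition : GoodPartition G
    goodPartition = side , side-cliques , side-sparse

  module SevenVertices {s : V G → Bool} (cliques : CliquePartition G s)
    (A : NonUniversalTriple (not ∘ s)) (B : NonUniversalTriple s) {w : V G} (universal : Universal G w) where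

    open K5-eFree G noK5-e cliques
    module A = NonUniversalTriple A
    module B = NonUniversalTriple B

    A-side : ∀ i → s (A.at i) ≡ true
    A-side i = not-injective (proj₂ (A.at-onFalse i))

    B-side : ∀ j → s (B.at j) ≡ false
    B-side j = proj₂ (B.at-onFalse j)

    A≢w : ∀ i → A.at i ≢ w
    A≢w i = universal≢nonUniversal G universal (proj₁ (A.at-onFalse i))

    B≢w : ∀ j → B.at j ≢ w
    B≢w j = universal≢nonUniversal G universal (proj₁ (B.at-onFalse j))

    A-B-opposite : ∀ i j → s (A.at i) ≢ s (B.at j)
    A-B-opposite i j eq with () ← trans (sym (A-side i)) (trans eq (B-side j))

    cross : Matrix
    cross i j = adj G (A.at i) (B.at j)

    place : Role → V G
    place (a i) = A.at i
    place (b j) = B.at j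
    place u     = w

    place-injective : ∀ {r r'} → place r ≡ place r' → r ≡ r'
    place-injective {a _} {a _} eq = cong a (A.at-injective eq)
    place-injective {b _} {b _} eq = cong b (B.at-injective eq)
    place-injective {u}   {u}   _  = refl
    place-injective {a i} {b j} eq = ⊥-elim (A-B-opposite i j (cong s eq))
    place-injective {b j} {a i} eq = ⊥-elim (A-B-opposite i j (cong s (sym eq)))
    place-injective {a i} {u}   eq = ⊥-elim (A≢w i eq)
    place-injective {u}   {a i} eq = ⊥-elim (A≢w i (sym eq))
    place-injective {b j} {u}   eq = ⊥-elim (B≢w j eq)
    place-injective {u}   {b j} eq = ⊥-elim (B≢w j (sym eq))

    place-adj : ∀ r r' → roleAdj cross r r' ≡ adj G (place r) (place r')
    place-adj (a i) (a j) with i Fin.≟ j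
    ... | yes refl = sym (irrefl G (A.at i))
    ... | no i≢j   = sym (cliques _ _ (i≢j ∘ A.at-injective) (trans (A-side i) (sym (A-side j))))
    place-adj (b i) (b j) with i Fin.≟ j
    ... | yes refl = sym (irrefl G (B.at i))
    ... | no i≢j   = sym (cliques _ _ (i≢j ∘ B.at-injective) (trans (B-side i) (sym (B-side j))))
    place-adj (a i) (b j) = refl
    place-adj (b j) (a i) = Graph.sym G (A.at i) (B.at j)
    place-adj (a i) u     = sym (Adj-sym G (universal _ (A≢w i)))
    place-adj (b j) u     = sym (Adj-sym G (universal _ (B≢w j)))
    place-adj u     (a i) = sym (universal _ (A≢w i))
    place-adj u     (b j) = sym (universal _ (B≢w j))
    place-adj u     u     = sym (irrefl G w)

    cross-crossing : ∀ i j → cross i j ≡ true → Crossing G s (A.at i) (B.at j)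
    cross-crossing i j = crossing (A-B-opposite i j)

    cross-matching : Matching cross
    cross-matching =
      (λ i j j' j≢j' aᵢbⱼ aᵢbⱼ' → nonUniversal⇒oneCrossingBesidesUniversal universal (proj₁ (A.at-onFalse i))
         (j≢j' ∘ B.at-injective) (B≢w j) (B≢w j') (cross-crossing i j aᵢbⱼ) (cross-crossing i j' aᵢbⱼ')) ,
      (λ i i' j i≢i' aᵢbⱼ aᵢ'bⱼ → nonUniversal⇒oneCrossingBesidesUniversal universal (proj₁ (B.at-onFalse j))
         (i≢i' ∘ A.at-injective) (A≢w i) (A≢w i')
         (Crossing-sym (cross-crossing i j aᵢbⱼ)) (Crossing-sym (cross-crossing i' j aᵢ'bⱼ)))

    contains-Forbidden : ∃[ k ] InducedSubgraph (Forbidden k) G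
    contains-Forbidden =
      let k , embedding = matching⇒Forbidden cross cross-matching
      in k , InducedSubgraph-trans {Forbidden k} {Pattern cross} {G}
               embedding (Pattern-embedding G place place-injective place-adj)

  cliquePartition⇒goodPartition : (∀ k → ¬ InducedSubgraph (Forbidden k) G) →
    ∀ {s} → CliquePartition G s → GoodPartition G
  cliquePartition⇒goodPartition noForbidden {s} cliques
    with nonUniversalTriple? s | nonUniversalTriple? (not ∘ s) | any? (universal? G)
  ... | inj₂ noTriple | _ | _ = MoveUniversals.goodPartition cliques noTriple
  ... | _ | inj₂ noTriple | _ =
    MoveUniversals.goodPartition (λ x y x≢y same → cliques x y x≢y (not-injective same)) noTriple
  ... | _ | _ | no noUniversal =
    s , cliques , λ x → K5-eFree.nonUniversal⇒atMostTwoCrossings G noK5-e cliques (λ u → noUniversal (x , u))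
  ... | inj₁ B | inj₁ A | yes (w , universal) =
    let k , embedding = SevenVertices.contains-Forbidden cliques A B universal
    in ⊥-elim (noForbidden k embedding)

-- Realising a family of pairs as the edge set of a graph

SamePair-map : {A B : Set} (f : A → B) → (∀ {a a'} → f a ≡ f a' → a ≡ a') → {P Q : A × A} →
  SamePair (f (proj₁ P) , f (proj₂ P)) (f (proj₁ Q) , f (proj₂ Q)) → SamePair P Q
SamePair-map f f-injective (inj₁ (p , q)) = inj₁ (f-injective p , f-injective q)
SamePair-map f f-injective (inj₂ (p , q)) = inj₂ (f-injective p , f-injective q)

module Realisation {N M : ℕ} {Name : Set}
  (encode : Name → Fin M) (encode-injective : ∀ {m m'} → encode m ≡ encode m' → m ≡ m')
  (ends : Fin N → Name × Name) (ends-distinct : ∀ x → proj₁ (ends x) ≢ proj₂ (ends x))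
  (ends-injective : ∀ {x y} → SamePair (ends x) (ends y) → x ≡ y) where

  code : Fin N → Fin M × Fin M
  code x = encode (proj₁ (ends x)) , encode (proj₂ (ends x))

  samePair? : (P Q : Fin M × Fin M) → Dec (SamePair P Q)
  samePair? P Q = (proj₁ P Fin.≟ proj₁ Q ×-dec proj₂ P Fin.≟ proj₂ Q)
           ⊎-dec (proj₁ P Fin.≟ proj₂ Q ×-dec proj₂ P Fin.≟ proj₁ Q)

  isEdge? : ∀ i j → Dec (∃[ x ] SamePair (code x) (i , j))
  isEdge? i j = any? λ x → samePair? (code x) (i , j)

  H : Graph
  H = record
    { n      = M
    ; adj    = λ i j → does (isEdge? i j)
    ; sym    = λ i j → does-⇔ (mk⇔ swap swap) (isEdge? i j) (isEdge? j i)
    ; irrefl = λ i → dec-false (isEdge? i i) λ (x , same) → ends-distinct x (encode-injective (loop same))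
    }
    where
      swap : ∀ {i j} → ∃[ x ] SamePair (code x) (i , j) → ∃[ x ] SamePair (code x) (j , i)
      swap (x , same) = x , SamePair-swap same
      loop : ∀ {P : Fin M × Fin M} {i} → SamePair P (i , i) → proj₁ P ≡ proj₂ P
      loop (inj₁ (p , q)) = trans p (sym q)
      loop (inj₂ (p , q)) = trans p (sym q)

  orient : ∀ i j → i ≢ j → Adj H i j → Edge H
  orient i j i≢j ij with Finₚ.<-cmp i j
  ... | tri< i<j _ _ = i , j , i<j , ij
  ... | tri≈ _ i≡j _ = ⊥-elim (i≢j i≡j)
  ... | tri> _ _ j<i = j , i , j<i , Adj-sym H ij

  orient-endpoints : ∀ i j i≢j ij → SamePair (endpoints H (orient i j i≢j ij)) (i , j)
  orient-endpoints i j i≢j ij with Finₚ.<-cmp i j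
  ... | tri< _ _ _   = inj₁ (refl , refl)
  ... | tri≈ _ i≡j _ = ⊥-elim (i≢j i≡j)
  ... | tri> _ _ _   = inj₂ (refl , refl)

  edge : Fin N → Edge H
  edge x = orient (proj₁ (code x)) (proj₂ (code x)) (ends-distinct x ∘ encode-injective)
                  (dec-true (isEdge? _ _) (x , inj₁ (refl , refl)))

  edge-endpoints : ∀ x → SamePair (endpoints H (edge x)) (code x)
  edge-endpoints x = orient-endpoints _ _ _ _

  vertexOf : Edge H → Fin N
  vertexOf (i , j , _ , ij) = proj₁ (witness (isEdge? i j) ij)

  vertexOf-endpoints : ∀ e → SamePair (code (vertexOf e)) (endpoints H e)
  vertexOf-endpoints (i , j , _ , ij) = proj₂ (witness (isEdge? i j) ij)

  Edge-ext : ∀ {e f} → SamePair (endpoints H e) (endpoints H f) → e ≡ f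
  Edge-ext {i , j , i<j , ij} {.i , .j , i<j' , ij'} (inj₁ (refl , refl))
    rewrite Finₚ.<-irrelevant i<j i<j' | Decidable⇒UIP.≡-irrelevant Bool._≟_ ij ij' = refl
  Edge-ext {_ , _ , i<j , _} {_ , _ , j<i , _} (inj₂ (refl , refl)) = ⊥-elim (Finₚ.<-asym i<j j<i)

  edgeOf : Fin N ↔ Edge H
  edgeOf = mk↔ₛ′ edge vertexOf
    (λ e → Edge-ext (SamePair-trans (edge-endpoints (vertexOf e)) (vertexOf-endpoints e)))
    (λ x → ends-injective (SamePair-map encode encode-injective
             (SamePair-trans (vertexOf-endpoints (edge x)) (edge-endpoints x))))

  end⇒incident : ∀ {x m} → m ∈ₚ ends x → Incident H (encode m) (edge x)
  end⇒incident {x} m∈ends = ∈ₚ-resp-SamePair (SamePair-sym (edge-endpoints x)) (Data.Sum.map (cong encode) (cong encode) m∈ends)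

  incident⇒end : ∀ {x v} → Incident H v (edge x) → ∃[ m ] encode m ≡ v × m ∈ₚ ends x
  incident⇒end {x} incident with ∈ₚ-resp-SamePair (edge-endpoints x) incident
  ... | inj₁ p = proj₁ (ends x) , p , inj₁ refl
  ... | inj₂ q = proj₂ (ends x) , q , inj₂ refl

  ShareEnd⇔commonEnd : ∀ x y → ShareEnd {H} (edge x) (edge y) ⇔ (∃[ m ] m ∈ₚ ends x × m ∈ₚ ends y)
  ShareEnd⇔commonEnd x y = mk⇔ common⇒ (λ (m , mx , my) → common⇒ShareEnd H (edge x) (edge y) (end⇒incident mx) (end⇒incident my))
    where
      common⇒ : ShareEnd {H} (edge x) (edge y) → ∃[ m ] m ∈ₚ ends x × m ∈ₚ ends y
      common⇒ share with ShareEnd⇒common H (edge x) (edge y) share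
      ... | v , vx , vy with incident⇒end vx | incident⇒end vy
      ... | m , refl , mx | m' , m'≡ , my with refl ← encode-injective m'≡ = m , mx , my

-- A good partition is realised by a proper 2-colour-line graph

module CrossingNames (G : Graph) {s : V G → Bool} (sparse : AtMostTwoCrossings G s) where

  data Crossings (x : V G) : Set where
    none : (∀ y → ¬ Crossing G s x y) → Crossings x
    one  : ∀ y → Crossing G s x y → (∀ y' → Crossing G s x y' → y' ≡ y) → Crossings x
    two  : ∀ y₁ y₂ → y₁ ≢ y₂ → Crossing G s x y₁ → Crossing G s x y₂ →
           (∀ y' → Crossing G s x y' → y' ≡ y₁ ⊎ y' ≡ y₂) → Crossings x

  crossings : ∀ x → Crossings x
  crossings x with any? (crossing? G s x)
  ... | no noCrossing = none λ y c → noCrossing (y , c)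
  ... | yes (y₁ , c₁) with any? (λ y → ¬? (y Fin.≟ y₁) ×-dec crossing? G s x y)
  ...   | no noOther = one y₁ c₁ λ y' c' → decidable-stable (y' Fin.≟ y₁) λ y'≢y₁ → noOther (y' , y'≢y₁ , c')
  ...   | yes (y₂ , y₂≢y₁ , c₂) = two y₁ y₂ (≢-sym y₂≢y₁) c₁ c₂ λ y' c' →
    decidable-stable ((y' Fin.≟ y₁) ⊎-dec (y' Fin.≟ y₂)) λ y'∉ →
      sparse x y₁ y₂ y' (≢-sym y₂≢y₁) (λ eq → y'∉ (inj₁ (sym eq))) (λ eq → y'∉ (inj₂ (sym eq))) c₁ c₂ c'

  -- The vertices of the realising graph: a crossing edge xy is named by its endpoint on side
  -- true, then its endpoint on side false; own x β are spare names private to x.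
  Name : Set
  Name = V G × V G × Bool

  linkFrom : Bool → V G → V G → Name
  linkFrom true  x y = x , y , false
  linkFrom false x y = y , x , false

  link : V G → V G → Name
  link x y = linkFrom (s x) x y

  own : V G → Bool → Name
  own x β = x , x , β

  link-sym : ∀ {x y} → s x ≢ s y → link x y ≡ link y x
  link-sym {x} {y} sx≢sy with s x | s y
  ... | true  | true  = ⊥-elim (sx≢sy refl)
  ... | true  | false = refl
  ... | false | true  = refl
  ... | false | false = ⊥-elim (sx≢sy refl)

  linkFrom-injective : ∀ β {x y y'} → linkFrom β x y ≡ linkFrom β x y' → y ≡ y'
  linkFrom-injective true  refl = refl
  linkFrom-injective false refl = refl

  linkFrom≢own : ∀ β {x y z β′} → x ≢ y → linkFrom β x y ≢ own z β′
  linkFrom≢own true  x≢y refl = x≢y refl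
  linkFrom≢own false x≢y refl = x≢y refl

  linkFrom-SamePair : ∀ β β' {x y x' y'} → linkFrom β x y ≡ linkFrom β' x' y' → SamePair (x , y) (x' , y')
  linkFrom-SamePair true  true  refl = inj₁ (refl , refl)
  linkFrom-SamePair true  false refl = inj₂ (refl , refl)
  linkFrom-SamePair false true  refl = inj₂ (refl , refl)
  linkFrom-SamePair false false refl = inj₁ (refl , refl)

  endsOf : ∀ {x} → Crossings x → Name × Name
  endsOf {x} (none _)              = own x true , own x false
  endsOf {x} (one y _ _)           = link x y , own x false
  endsOf {x} (two y₁ y₂ _ _ _ _)   = link x y₁ , link x y₂

  ends : V G → Name × Name
  ends x = endsOf (crossings x)

  endsOf-distinct : ∀ {x} (c : Crossings x) → proj₁ (endsOf c) ≢ proj₂ (endsOf c)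
  endsOf-distinct (none _) ()
  endsOf-distinct {x} (one _ c _) = linkFrom≢own (s x) (Adj⇒≢ G (adjacent c))
  endsOf-distinct {x} (two _ _ y₁≢y₂ _ _ _) = y₁≢y₂ ∘ linkFrom-injective (s x)

  endsOf-shape : ∀ {x m} (c : Crossings x) → m ∈ₚ endsOf c →
    (∃[ β ] m ≡ own x β) ⊎ (∃[ y ] Crossing G s x y × m ≡ link x y)
  endsOf-shape (none _)                (inj₁ refl) = inj₁ (true , refl)
  endsOf-shape (none _)                (inj₂ refl) = inj₁ (false , refl)
  endsOf-shape (one y c _)             (inj₁ refl) = inj₂ (y , c , refl)
  endsOf-shape (one _ _ _)             (inj₂ refl) = inj₁ (false , refl)
  endsOf-shape (two y₁ _ _ c₁ _ _)     (inj₁ refl) = inj₂ (y₁ , c₁ , refl)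
  endsOf-shape (two _ y₂ _ _ c₂ _)     (inj₂ refl) = inj₂ (y₂ , c₂ , refl)

  crossing⇒link∈endsOf : ∀ {x y} (c : Crossings x) → Crossing G s x y → link x y ∈ₚ endsOf c
  crossing⇒link∈endsOf (none noCrossing) c = ⊥-elim (noCrossing _ c)
  crossing⇒link∈endsOf (one _ _ unique) c with refl ← unique _ c = inj₁ refl
  crossing⇒link∈endsOf (two _ _ _ _ _ onlyTwo) c with onlyTwo _ c
  ... | inj₁ refl = inj₁ refl
  ... | inj₂ refl = inj₂ refl

  crossing⇒link∈ends : ∀ {x y} → Crossing G s x y → link x y ∈ₚ ends x
  crossing⇒link∈ends {x} = crossing⇒link∈endsOf (crossings x)

  commonEnd⇒crossing : ∀ {x y m} → x ≢ y → m ∈ₚ ends x → m ∈ₚ ends y → Crossing G s x y × m ≡ link x y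
  commonEnd⇒crossing {x} {y} x≢y mx my with endsOf-shape (crossings x) mx | endsOf-shape (crossings y) my
  ... | inj₁ (_ , refl) | inj₁ (_ , refl)      = ⊥-elim (x≢y refl)
  ... | inj₁ (_ , refl) | inj₂ (_ , c , m≡)    = ⊥-elim (linkFrom≢own (s y) (Adj⇒≢ G (adjacent c)) (sym m≡))
  ... | inj₂ (_ , c , m≡) | inj₁ (_ , refl)    = ⊥-elim (linkFrom≢own (s x) (Adj⇒≢ G (adjacent c)) (sym m≡))
  ... | inj₂ (x' , c , refl) | inj₂ (y' , c' , m≡) with linkFrom-SamePair (s x) (s y) m≡
  ...   | inj₁ (x≡y , _)      = ⊥-elim (x≢y x≡y)
  ...   | inj₂ (refl , refl)  = c , refl

  ends-distinct : ∀ x → proj₁ (ends x) ≢ proj₂ (ends x)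
  ends-distinct x = endsOf-distinct (crossings x)

  -- Distinct vertices share at most the one name link x y, while each has two distinct names.
  ends-injective : ∀ {x y} → SamePair (ends x) (ends y) → x ≡ y
  ends-injective {x} {y} same = decidable-stable (x Fin.≟ y) λ x≢y →
    ends-distinct x (trans (proj₂ (commonEnd⇒crossing x≢y (inj₁ refl) (∈ₚ-resp-SamePair same (inj₁ refl))))
                      (sym (proj₂ (commonEnd⇒crossing x≢y (inj₂ refl) (∈ₚ-resp-SamePair same (inj₂ refl))))))

module ColourLineRealisation (G : Graph) {s : V G → Bool} (cliques : CliquePartition G s) (sparse : AtMostTwoCrossings G s) where

  open CrossingNames G sparse

  encode : Name → Fin (n G * n G * 2)
  encode (p , q , β) = combine (combine p q) (colourOf β)

  encode-injective : ∀ {m m'} → encode m ≡ encode m' → m ≡ m'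
  encode-injective {p , q , β} {p' , q' , β'} eq =
    let pq≡ , β≡ = Finₚ.combine-injective (combine p q) (colourOf β) (combine p' q') (colourOf β') eq
        p≡ , q≡ = Finₚ.combine-injective p q p' q' pq≡
    in cong₂ _,_ p≡ (cong₂ _,_ q≡ (colourOf-injective β≡))

  open Realisation encode encode-injective ends ends-distinct ends-injective public

  φ : Edge H → Fin 2
  φ e = colourOf (s (vertexOf e))

  φ-edge : ∀ x → φ (edge x) ≡ colourOf (s x)
  φ-edge x = cong (colourOf ∘ s) (Inverse.strictlyInverseʳ edgeOf x)

  edge-injective : ∀ {x y} → edge x ≡ edge y → x ≡ y
  edge-injective = Injection.injective (↔⇒↣ edgeOf)

  ShareEnd⇒crossing : ∀ {x y} → x ≢ y → ShareEnd {H} (edge x) (edge y) → Crossing G s x y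
  ShareEnd⇒crossing {x} {y} x≢y share =
    let m , mx , my = Equivalence.to (ShareEnd⇔commonEnd x y) share
    in proj₁ (commonEnd⇒crossing x≢y mx my)

  crossing⇒ShareEnd : ∀ {x y} → Crossing G s x y → ShareEnd {H} (edge x) (edge y)
  crossing⇒ShareEnd {x} {y} c = Equivalence.from (ShareEnd⇔commonEnd x y)
    (link x y , crossing⇒link∈ends c , subst (_∈ₚ ends y) (sym (link-sym (opposite c))) (crossing⇒link∈ends (Crossing-sym c)))

  proper : ProperColouring H φ
  proper e f e≢f share sameColour =
    opposite (ShareEnd⇒crossing x≢y (subst₂ (ShareEnd {H}) (sym (to-from e)) (sym (to-from f)) share))
             (colourOf-injective sameColour)
    where
      to-from = Inverse.strictlyInverseˡ edgeOf
      x≢y : vertexOf e ≢ vertexOf f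
      x≢y eq = e≢f (trans (sym (to-from e)) (trans (cong edge eq) (to-from f)))

  iso : IsoCL G H φ
  iso = edgeOf , λ x y → adj⇒CLAdj , CLAdj⇒adj
    where
      adj⇒CLAdj : ∀ {x y} → Adj G x y → CLAdj H φ (edge x) (edge y)
      adj⇒CLAdj {x} {y} xy = Adj⇒≢ G xy ∘ edge-injective , shareOrSameColour (s x Bool.≟ s y)
        where
          shareOrSameColour : Dec (s x ≡ s y) → ShareEnd {H} (edge x) (edge y) ⊎ φ (edge x) ≡ φ (edge y)
          shareOrSameColour (yes same)    = inj₂ (trans (φ-edge x) (trans (cong colourOf same) (sym (φ-edge y))))
          shareOrSameColour (no opposite) = inj₁ (crossing⇒ShareEnd (crossing opposite xy))
      CLAdj⇒adj : ∀ {x y} → CLAdj H φ (edge x) (edge y) → Adj G x y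
      CLAdj⇒adj {x} {y} (e≢f , inj₁ share)      = adjacent (ShareEnd⇒crossing (e≢f ∘ cong edge) share)
      CLAdj⇒adj {x} {y} (e≢f , inj₂ sameColour) =
        cliques x y (e≢f ∘ cong edge) (colourOf-injective (trans (sym (φ-edge x)) (trans sameColour (φ-edge y))))

goodPartition⇒proper2ColourLine : (G : Graph) → GoodPartition G → Proper2ColourLine G
goodPartition⇒proper2ColourLine G (s , cliques , sparse) = H , φ , proper , iso
  where open ColourLineRealisation G cliques sparse

CoBipartiteAndFree : Graph → Set
CoBipartiteAndFree G = CoBipartite G
  × ¬ InducedSubgraph K5-e G × ¬ InducedSubgraph F₁ G × ¬ InducedSubgraph F₂ G
  × ¬ InducedSubgraph F₃ G × ¬ InducedSubgraph F₄ G

goodPartition⇒coBipartiteAndFree : (G : Graph) → GoodPartition G → CoBipartiteAndFree G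
goodPartition⇒coBipartiteAndFree G good@(s , cliques , _) =
  (s , cliques) ,
  (λ i → K5-e-noGoodPartition (GoodPartition-induced {K5-e} {G} i good)) ,
  (λ i → Forbidden-noGoodPartition 0F (GoodPartition-induced {F₁} {G} i good)) ,
  (λ i → Forbidden-noGoodPartition 1F (GoodPartition-induced {F₂} {G} i good)) ,
  (λ i → Forbidden-noGoodPartition 2F (GoodPartition-induced {F₃} {G} i good)) ,
  (λ i → Forbidden-noGoodPartition 3F (GoodPartition-induced {F₄} {G} i good))

coBipartiteAndFree⇒goodPartition : (G : Graph) → CoBipartiteAndFree G → GoodPartition G
coBipartiteAndFree⇒goodPartition G ((s , cliques) , noK5-e , no₁ , no₂ , no₃ , no₄) =
  GoodRepartition.cliquePartition⇒goodPartition G noK5-e noForbidden {s} cliques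
  where
    noForbidden : ∀ k → ¬ InducedSubgraph (Forbidden k) G
    noForbidden 0F = no₁
    noForbidden 1F = no₂
    noForbidden 2F = no₃
    noForbidden 3F = no₄

theorem9 : (G : Graph) →
    Proper2ColourLine G ⇔
      (CoBipartite G
        × ¬ InducedSubgraph K5-e G
        × ¬ InducedSubgraph F₁ G
        × ¬ InducedSubgraph F₂ G
        × ¬ InducedSubgraph F₃ G
        × ¬ InducedSubgraph F₄ G)
theorem9 G = mk⇔
  (goodPartition⇒coBipartiteAndFree G ∘ proper2ColourLine⇒goodPartition G)
  (goodPartition⇒proper2ColourLine G ∘ coBipartiteAndFree⇒goodPartition G)
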